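{- Any finite simple graph $G$ that has a perfect matching consisting only of pendant edges is $\alpha_{P_3}^{+}$-stable.
   Context: $\alpha(G)$ is the maximum size of a stable set. A pendant edge is an edge $vw$ with $v$ having exactly one neighbour. For $e\in E(\overline{G})$ (a pair of distinct non-adjacent vertices), $G+e$ denotes $G$ with $e$ added. $G$ is $\alpha_{P_3}^{+}$-stable if $\alpha(G+e_1+e_2)=\alpha(G)$ for any $e_1,e_2\in E(\overline{G})$ (not necessarily distinct) that have a common endpoint. -}

module Defs where

open import Data.Nat using (ℕ; _≤_)
open import Data.Bool using (Bool; true; false; _∨_; _∧_)
open import Data.Fin using (Fin; _≟_)
open import Data.Fin.Subset using (Subset; _∈_; ∣_∣)
open import Data.Product using (Σ; _×_; ∃)
open import Data.Sum using (_⊎_)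
open import Relation.Nullary using (¬_)
open import Relation.Nullary.Decidable using (⌊_⌋)
open import Relation.Binary.PropositionalEquality using (_≡_; _≢_)

record Graph (n : ℕ) : Set where
  field
    adj    : Fin n → Fin n → Bool
    sym    : ∀ x y → adj x y ≡ adj y x
    irrefl : ∀ x → adj x x ≡ false
open Graph public

Adj : ∀ {n} → Graph n → Fin n → Fin n → Set
Adj G x y = adj G x y ≡ true

NonEdge : ∀ {n} → Graph n → Fin n → Fin n → Set
NonEdge G u v = (u ≢ v) × (¬ Adj G u v)

private
  is-uv : ∀ {n} → Fin n → Fin n → Fin n → Fin n → Bool
  is-uv u v x y = (⌊ x ≟ u ⌋ ∧ ⌊ y ≟ v ⌋) ∨ (⌊ x ≟ v ⌋ ∧ ⌊ y ≟ u ⌋)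

addEdge : ∀ {n} (G : Graph n) (u v : Fin n) → u ≢ v → Graph n
addEdge G u v u≢v = record
  { adj    = λ x y → adj G x y ∨ is-uv u v x y
  ; sym    = λ x y → symProof x y
  ; irrefl = λ x → irreflProof x
  }
  where
  open import Data.Bool.Properties using (∨-comm; ∧-comm)
  open import Relation.Binary.PropositionalEquality using (cong₂; refl; sym; trans)
  open import Relation.Nullary using (yes; no)
  open import Data.Empty using (⊥-elim)
  symProof : ∀ x y → (adj G x y ∨ is-uv u v x y) ≡ (adj G y x ∨ is-uv u v y x)
  symProof x y = cong₂ _∨_ (Graph.sym G x y)
    (trans (cong₂ _∨_ (∧-comm ⌊ x ≟ u ⌋ ⌊ y ≟ v ⌋) (∧-comm ⌊ x ≟ v ⌋ ⌊ y ≟ u ⌋))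
           (∨-comm (⌊ y ≟ v ⌋ ∧ ⌊ x ≟ u ⌋) (⌊ y ≟ u ⌋ ∧ ⌊ x ≟ v ⌋)))
  irreflProof : ∀ x → (adj G x x ∨ is-uv u v x x) ≡ false
  irreflProof x rewrite Graph.irrefl G x with x ≟ u | x ≟ v
  ... | yes refl | yes refl = ⊥-elim (u≢v refl)
  ... | yes _ | no _ = refl
  ... | no _ | yes _ = refl
  ... | no _ | no _ = refl

IsStable : ∀ {n} → Graph n → Subset n → Set
IsStable G S = ∀ x y → x ∈ S → y ∈ S → ¬ Adj G x y

IsAlpha : ∀ {n} → Graph n → ℕ → Set
IsAlpha G k = (Σ (Subset _) λ S → IsStable G S × ∣ S ∣ ≡ k)
            × (∀ S → IsStable G S → ∣ S ∣ ≤ k)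

IsSoleNeighbour : ∀ {n} → Graph n → Fin n → Fin n → Set
IsSoleNeighbour G v w = Adj G v w × (∀ x → Adj G v x → x ≡ w)

IsPendantEdge : ∀ {n} → Graph n → Fin n → Fin n → Set
IsPendantEdge G v w = IsSoleNeighbour G v w ⊎ IsSoleNeighbour G w v

-- A perfect matching given by its partner map m: every vertex v is matched
-- by the edge v (m v), with m a fixed-point-free involution.
IsPerfectMatching : ∀ {n} → Graph n → (Fin n → Fin n) → Set
IsPerfectMatching G m = ∀ v → Adj G v (m v) × m (m v) ≡ v

HasPendantPerfectMatching : ∀ {n} → Graph n → Set
HasPendantPerfectMatching G =
  Σ (Fin _ → Fin _) λ m → IsPerfectMatching G m × (∀ v → IsPendantEdge G v (m v))

-- α⁺_{P3}-stability: adding two non-edges sharing an endpoint u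
-- (possibly the same non-edge twice) does not change α.
IsAlphaP3PlusStable : ∀ {n} → Graph n → Set
IsAlphaP3PlusStable {n} G =
  ∀ (u v w : Fin n) (e₁ : NonEdge G u v) (e₂ : NonEdge G u w) →
  (k : ℕ) → IsAlpha G k →
  IsAlpha (addEdge (addEdge G u v (Data.Product.proj₁ e₁)) u w (Data.Product.proj₁ e₂)) k

-- Let m be the partner map of the pendant perfect matching. Every stable set meets each
-- matching edge {x, m x} at most once, so α(G) ≤ n/2. Conversely, for any vertex u, take
-- m u together with one leaf from every other matching edge: a leaf's only neighbour is its
-- partner, so this is a stable set of size n/2 that avoids u. Edges added at u cannot break
-- its stability, and adding edges never increases α, so α is unchanged.
module Submission where

open import Data.Nat using (ℕ)
open import Defs

open import Data.Bool using (true; false; if_then_else_)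
open import Data.Bool.Properties using () renaming (_≟_ to _≟ᵇ_)
open import Data.Empty using (⊥-elim)
open import Data.Fin using (Fin; zero; suc; _<_; _≟_)
open import Data.Fin.Permutation using (permutation)
open import Data.Fin.Properties using (all?; _<?_; <-cmp; <-asym)
open import Data.Fin.Subset using (Subset; _∈_; _∉_; ∣_∣)
open import Data.Fin.Subset.Properties using (_∈?_)
open import Data.Nat as ℕ using (_+_; _*_; _≤_; z≤n; s≤s)
open import Data.Nat.Properties
  using ( +-0-commutativeMonoid; ≤-antisym; ≤-trans; +-mono-≤; *-cancelˡ-≤; +-identityʳ; m≤n+m
        ; module ≤-Reasoning)
open import Data.Product using (_×_; _,_; proj₁; proj₂)
open import Data.Sum using (_⊎_; inj₁; inj₂; [_,_]′)
open import Data.Vec using ([]; _∷_; lookup; tabulate)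
open import Data.Vec.Properties using ([]=⇒lookup; lookup⇒[]=; lookup∘tabulate)
open import Function using (_∘_)
open import Level using (Level)
open import Relation.Binary.Definitions using (tri<; tri≈; tri>)
open import Relation.Binary.PropositionalEquality as ≡
  using (_≡_; _≢_; refl; trans; cong; subst; module ≡-Reasoning)
open import Relation.Nullary using (¬_; yes; no; does)
open import Relation.Nullary.Decidable using (_×-dec_; _⊎-dec_; _→-dec_; ¬?; dec-true)
open import Relation.Unary using (Pred; Decidable)
open import Algebra.Properties.CommutativeMonoid.Sum +-0-commutativeMonoid
  using (sum; sum-permute; ∑-distrib-+)

private
  variable
    n : ℕ
    ℓ : Level

⟦_⟧ : {P : Pred (Fin n) ℓ} → Decidable P → Subset n
⟦ P? ⟧ = tabulate (does ∘ P?)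

module _ {P : Pred (Fin n) ℓ} (P? : Decidable P) {x : Fin n} where

  ∈⟦⟧⁺ : P x → x ∈ ⟦ P? ⟧
  ∈⟦⟧⁺ px = lookup⇒[]= x ⟦ P? ⟧ (trans (lookup∘tabulate (does ∘ P?) x) (dec-true (P? x) px))

  ∈⟦⟧⁻ : x ∈ ⟦ P? ⟧ → P x
  ∈⟦⟧⁻ x∈ with P? x | trans (≡.sym (lookup∘tabulate (does ∘ P?) x)) ([]=⇒lookup x∈)
  ... | yes px | _ = px

𝟙 : Subset n → Fin n → ℕ
𝟙 p x = if lookup p x then 1 else 0

∣p∣≡∑𝟙 : (p : Subset n) → ∣ p ∣ ≡ sum (𝟙 p)
∣p∣≡∑𝟙 []          = refl
∣p∣≡∑𝟙 (true ∷ p)  = cong ℕ.suc (∣p∣≡∑𝟙 p)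
∣p∣≡∑𝟙 (false ∷ p) = ∣p∣≡∑𝟙 p

module _ {p : Subset n} {x : Fin n} where

  𝟙-∈ : x ∈ p → 𝟙 p x ≡ 1
  𝟙-∈ x∈p rewrite []=⇒lookup x∈p = refl

  𝟙-∉ : x ∉ p → 𝟙 p x ≡ 0
  𝟙-∉ x∉p with lookup p x in eq
  ... | true  = ⊥-elim (x∉p (lookup⇒[]= x p eq))
  ... | false = refl

∑-mono-≤ : {f g : Fin n → ℕ} → (∀ i → f i ≤ g i) → sum f ≤ sum g
∑-mono-≤ {ℕ.zero}  f≤g = z≤n
∑-mono-≤ {ℕ.suc n} f≤g = +-mono-≤ (f≤g zero) (∑-mono-≤ (f≤g ∘ suc))

module _ {p : Subset n} {x y : Fin n} where

  𝟙-pair-≤1 : ¬ (x ∈ p × y ∈ p) → 𝟙 p x + 𝟙 p y ≤ 1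
  𝟙-pair-≤1 ¬both with x ∈? p | y ∈? p
  ... | yes x∈p | yes y∈p = ⊥-elim (¬both (x∈p , y∈p))
  ... | yes x∈p | no  y∉p rewrite 𝟙-∈ x∈p | 𝟙-∉ y∉p = s≤s z≤n
  ... | no  x∉p | yes y∈p rewrite 𝟙-∉ x∉p | 𝟙-∈ y∈p = s≤s z≤n
  ... | no  x∉p | no  y∉p rewrite 𝟙-∉ x∉p | 𝟙-∉ y∉p = z≤n

  𝟙-pair-≥1 : x ∈ p ⊎ y ∈ p → 1 ≤ 𝟙 p x + 𝟙 p y
  𝟙-pair-≥1 (inj₁ x∈p) rewrite 𝟙-∈ x∈p = s≤s z≤n
  𝟙-pair-≥1 (inj₂ y∈p) rewrite 𝟙-∈ y∈p = m≤n+m 1 (𝟙 p x)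

PairFree : (Fin n → Fin n) → Subset n → Set
PairFree m T = ∀ x → ¬ (x ∈ T × m x ∈ T)

PairCovering : (Fin n → Fin n) → Subset n → Set
PairCovering m S = ∀ x → x ∈ S ⊎ m x ∈ S

module Involution (m : Fin n → Fin n) (m-involutive : ∀ x → m (m x) ≡ x) where

  ∑-pairs : (f : Fin n → ℕ) → sum (λ x → f x + f (m x)) ≡ 2 * sum f
  ∑-pairs f = begin
    sum (λ x → f x + f (m x)) ≡⟨ ∑-distrib-+ f (f ∘ m) ⟩
    sum f + sum (f ∘ m)       ≡⟨ cong (sum f +_) (sum-permute f m-perm) ⟨
    sum f + sum f             ≡⟨ cong (sum f +_) (+-identityʳ (sum f)) ⟨
    2 * sum f                 ∎
    where
    open ≡-Reasoning
    m-perm = permutation m m m-involutive m-involutive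

  ∣PairFree∣≤∣PairCovering∣ : ∀ {T S} → PairFree m T → PairCovering m S → ∣ T ∣ ≤ ∣ S ∣
  ∣PairFree∣≤∣PairCovering∣ {T} {S} T-free S-covering = *-cancelˡ-≤ 2 (begin
    2 * ∣ T ∣                       ≡⟨ cong (2 *_) (∣p∣≡∑𝟙 T) ⟩
    2 * sum (𝟙 T)                   ≡⟨ ∑-pairs (𝟙 T) ⟨
    sum (λ x → 𝟙 T x + 𝟙 T (m x))  ≤⟨ ∑-mono-≤ pair-≤ ⟩
    sum (λ x → 𝟙 S x + 𝟙 S (m x))  ≡⟨ ∑-pairs (𝟙 S) ⟩
    2 * sum (𝟙 S)                   ≡⟨ cong (2 *_) (∣p∣≡∑𝟙 S) ⟨
    2 * ∣ S ∣                       ∎)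
    where
    open ≤-Reasoning
    pair-≤ : ∀ x → 𝟙 T x + 𝟙 T (m x) ≤ 𝟙 S x + 𝟙 S (m x)
    pair-≤ x = ≤-trans (𝟙-pair-≤1 (T-free x)) (𝟙-pair-≥1 (S-covering x))

module OneOfEachPair (m : Fin n → Fin n)
    (m-involutive : ∀ x → m (m x) ≡ x) (m-fixfree : ∀ x → x ≢ m x)
    {P : Pred (Fin n) ℓ} (P? : Decidable P) (P-covering : ∀ x → P x ⊎ P (m x)) where

  Picked : Pred (Fin n) ℓ
  Picked x = P x × (P (m x) → x < m x)

  picked? : Decidable Picked
  picked? x = P? x ×-dec (P? (m x) →-dec x <? m x)

  private
    P-m⁻ : ∀ {x} → P (m (m x)) → P x
    P-m⁻ = subst P (m-involutive _)

    P-m⁺ : ∀ {x} → P x → P (m (m x))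
    P-m⁺ = subst P (≡.sym (m-involutive _))

  picked-covering : ∀ x → Picked x ⊎ Picked (m x)
  picked-covering x with P? x | P? (m x)
  ... | yes px  | no ¬pmx = inj₁ (px , ⊥-elim ∘ ¬pmx)
  ... | no ¬px  | yes pmx = inj₂ (pmx , ⊥-elim ∘ ¬px ∘ P-m⁻)
  ... | no ¬px  | no ¬pmx = ⊥-elim ([ ¬px , ¬pmx ]′ (P-covering x))
  ... | yes px  | yes pmx with <-cmp x (m x)
  ...   | tri< x<mx _ _   = inj₁ (px , λ _ → x<mx)
  ...   | tri≈ _ x≡mx _   = ⊥-elim (m-fixfree x x≡mx)
  ...   | tri> _ _ mx<x   = inj₂ (pmx , λ _ → subst (m x <_) (≡.sym (m-involutive x)) mx<x)

  picked-unique : ∀ x → Picked x → ¬ Picked (m x)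
  picked-unique x (px , x<mx) (pmx , mx<mmx) =
    <-asym (x<mx pmx) (subst (m x <_) (m-involutive x) (mx<mmx (P-m⁺ px)))

module _ (G : Graph n) {x y : Fin n} where

  Adj-sym : Adj G x y → Adj G y x
  Adj-sym xy = trans (Graph.sym G y x) xy

  Adj⇒≢ : Adj G x y → x ≢ y
  Adj⇒≢ xy refl with trans (≡.sym xy) (irrefl G x)
  ... | ()

infix 4 _⊆ᴱ_
_⊆ᴱ_ : Graph n → Graph n → Set
G ⊆ᴱ H = ∀ {x y} → Adj G x y → Adj H x y

module _ {G : Graph n} {u v : Fin n} {u≢v : u ≢ v} where

  ⊆ᴱ-addEdge : G ⊆ᴱ addEdge G u v u≢v
  ⊆ᴱ-addEdge {x} {y} xy with adj G x y
  ⊆ᴱ-addEdge refl | true = refl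

  Adj-addEdge⁻ : ∀ {x y} → Adj (addEdge G u v u≢v) x y →
                 Adj G x y ⊎ (x ≡ u × y ≡ v) ⊎ (x ≡ v × y ≡ u)
  Adj-addEdge⁻ {x} {y} xy with adj G x y | x ≟ u | y ≟ v | x ≟ v | y ≟ u
  ... | true  | _        | _        | _        | _        = inj₁ refl
  ... | false | yes refl | yes refl | _        | _        = inj₂ (inj₁ (refl , refl))
  ... | false | _        | _        | yes refl | yes refl = inj₂ (inj₂ (refl , refl))
  Adj-addEdge⁻ () | false | no _  | _    | no _  | _
  Adj-addEdge⁻ () | false | yes _ | no _ | no _  | _
  Adj-addEdge⁻ () | false | yes _ | no _ | yes _ | no _
  Adj-addEdge⁻ () | false | no _  | _    | yes _ | no _

  IsStable-addEdge : ∀ {S} → IsStable G S → ¬ (u ∈ S × v ∈ S) →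
                     IsStable (addEdge G u v u≢v) S
  IsStable-addEdge S-stable ¬uv x y x∈S y∈S xy with Adj-addEdge⁻ xy
  ... | inj₁ xy′                  = S-stable x y x∈S y∈S xy′
  ... | inj₂ (inj₁ (refl , refl)) = ¬uv (x∈S , y∈S)
  ... | inj₂ (inj₂ (refl , refl)) = ¬uv (y∈S , x∈S)

IsStable-antimono : ∀ {G H : Graph n} {S} → G ⊆ᴱ H → IsStable H S → IsStable G S
IsStable-antimono G⊆H S-stable x y x∈S y∈S = S-stable x y x∈S y∈S ∘ G⊆H

IsAlpha-supergraph : ∀ {G H : Graph n} {k S} →
                     G ⊆ᴱ H → IsAlpha G k → IsStable H S → k ≤ ∣ S ∣ → IsAlpha H k
IsAlpha-supergraph {G = G} {H} {S = S} G⊆H (_ , α-max) S-stable k≤∣S∣ =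
  (S , S-stable , ≤-antisym (α-max S (antimono S-stable)) k≤∣S∣)
  , λ T → α-max T ∘ antimono
  where
  antimono : ∀ {T} → IsStable H T → IsStable G T
  antimono = IsStable-antimono {G = G} {H} G⊆H

IsStable⇒PairFree : ∀ {G : Graph n} {m T} → IsPerfectMatching G m → IsStable G T → PairFree m T
IsStable⇒PairFree m-matching T-stable x (x∈T , mx∈T) =
  T-stable x _ x∈T mx∈T (proj₁ (m-matching x))

module PendantPerfectMatching (G : Graph n) {m : Fin n → Fin n}
    (m-matching : IsPerfectMatching G m) (m-pendant : ∀ v → IsPendantEdge G v (m v)) where

  m-involutive : ∀ x → m (m x) ≡ x
  m-involutive = proj₂ ∘ m-matching

  m-injective : ∀ {x y} → m x ≡ m y → x ≡ y
  m-injective {x} {y} mx≡my = begin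
    x         ≡⟨ m-involutive x ⟨
    m (m x)   ≡⟨ cong m mx≡my ⟩
    m (m y)   ≡⟨ m-involutive y ⟩
    y         ∎
    where open ≡-Reasoning

  m-fixfree : ∀ x → x ≢ m x
  m-fixfree x = Adj⇒≢ G (proj₁ (m-matching x))

  Leaf : Pred (Fin n) _
  Leaf x = IsSoleNeighbour G x (m x)

  leaf? : Decidable Leaf
  leaf? x = (adj G x (m x) ≟ᵇ true) ×-dec all? (λ y → (adj G x y ≟ᵇ true) →-dec (y ≟ m x))

  leaf-partner : ∀ {x y} → Leaf x → Adj G x y → y ≡ m x
  leaf-partner (_ , x-sole) = x-sole _

  leaf-covering : ∀ x → Leaf x ⊎ Leaf (m x)
  leaf-covering x with m-pendant x
  ... | inj₁ x-leaf  = inj₁ x-leaf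
  ... | inj₂ mx-leaf = inj₂ (subst (IsSoleNeighbour G (m x)) (≡.sym (m-involutive x)) mx-leaf)

  open OneOfEachPair m m-involutive m-fixfree leaf? leaf-covering

  module _ (u : Fin n) where

    InStableAvoiding : Pred (Fin n) _
    InStableAvoiding x = x ≡ m u ⊎ (x ≢ u × Picked x)

    inStableAvoiding? : Decidable InStableAvoiding
    inStableAvoiding? x = (x ≟ m u) ⊎-dec (¬? (x ≟ u) ×-dec picked? x)

    stableAvoiding : Subset n
    stableAvoiding = ⟦ inStableAvoiding? ⟧

    private
      ∈⁺ : ∀ {x} → InStableAvoiding x → x ∈ stableAvoiding
      ∈⁺ = ∈⟦⟧⁺ inStableAvoiding?

      ∈⁻ : ∀ {x} → x ∈ stableAvoiding → InStableAvoiding x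
      ∈⁻ = ∈⟦⟧⁻ inStableAvoiding?

    u∉stableAvoiding : u ∉ stableAvoiding
    u∉stableAvoiding u∈ with ∈⁻ u∈
    ... | inj₁ u≡mu      = m-fixfree u u≡mu
    ... | inj₂ (u≢u , _) = u≢u refl

    stableAvoiding-covering : PairCovering m stableAvoiding
    stableAvoiding-covering x with x ≟ m u | x ≟ u
    ... | yes x≡mu | _        = inj₁ (∈⁺ (inj₁ x≡mu))
    ... | no _     | yes refl = inj₂ (∈⁺ (inj₁ refl))
    ... | no x≢mu  | no x≢u with picked-covering x
    ...   | inj₁ x-picked  = inj₁ (∈⁺ (inj₂ (x≢u , x-picked)))
    ...   | inj₂ mx-picked = inj₂ (∈⁺ (inj₂ (x≢mu ∘ mx≡u⇒x≡mu , mx-picked)))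
      where
      mx≡u⇒x≡mu : m x ≡ u → x ≡ m u
      mx≡u⇒x≡mu mx≡u = trans (≡.sym (m-involutive x)) (cong m mx≡u)

    stableAvoiding-stable : IsStable G stableAvoiding
    stableAvoiding-stable x y x∈ y∈ xy with ∈⁻ x∈ | ∈⁻ y∈
    ... | inj₁ refl         | inj₁ refl         = Adj⇒≢ G xy refl
    ... | inj₁ refl         | inj₂ (y≢u , y-pk) =
      y≢u (≡.sym (m-injective (leaf-partner (proj₁ y-pk) (Adj-sym G xy))))
    ... | inj₂ (x≢u , x-pk) | inj₁ refl         =
      x≢u (≡.sym (m-injective (leaf-partner (proj₁ x-pk) xy)))
    ... | inj₂ (_ , x-pk)   | inj₂ (_ , y-pk)   =
      picked-unique x x-pk (subst Picked (leaf-partner (proj₁ x-pk) xy) y-pk)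

proposition12 : ∀ (n : ℕ) (G : Graph n) → HasPendantPerfectMatching G → IsAlphaP3PlusStable G
proposition12 n G (m , m-matching , m-pendant) u v w (u≢v , _) (u≢w , _) k
              α-G@((T , T-stable , ∣T∣≡k) , _) =
  IsAlpha-supergraph {G = G} {H = G⁺} G⊆G⁺ α-G S-stable⁺ k≤∣S∣
  where
  G⁺ : Graph n
  G⁺ = addEdge (addEdge G u v u≢v) u w u≢w

  G⊆G⁺ : G ⊆ᴱ G⁺
  G⊆G⁺ = ⊆ᴱ-addEdge {G = addEdge G u v u≢v} {u≢v = u≢w} ∘ ⊆ᴱ-addEdge {G = G} {u≢v = u≢v}

  open PendantPerfectMatching G m-matching m-pendant
  open Involution m m-involutive

  S : Subset n
  S = stableAvoiding u

  u∉S : ∀ {x} → ¬ (u ∈ S × x ∈ S)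
  u∉S = u∉stableAvoiding u ∘ proj₁

  S-stable⁺ : IsStable G⁺ S
  S-stable⁺ = IsStable-addEdge {G = addEdge G u v u≢v} {u≢v = u≢w}
    (IsStable-addEdge {G = G} {u≢v = u≢v} (stableAvoiding-stable u) u∉S) u∉S

  k≤∣S∣ : k ≤ ∣ S ∣
  k≤∣S∣ = subst (_≤ ∣ S ∣) ∣T∣≡k
    (∣PairFree∣≤∣PairCovering∣ (IsStable⇒PairFree {G = G} m-matching T-stable)
                               (stableAvoiding-covering u))
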